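{- For integers $n \ge 1$ and $k \ge 0$, let $A(n,k)$ be the set of $132$-avoiding permutations of length $n$ having exactly $k$ short values. Then \[ |A(n,k)| = T_{n-1,k}, \qquad \text{where } T_{n,k} = \frac{n-k+1}{n+1}\binom{n+k}{n}. \]
   Context: A permutation avoids $132$ if it has no subsequence order-isomorphic to $132$. An entry $\pi_i$ of a permutation $\pi = \pi_1\cdots\pi_n$ is a right-to-left maximum if $\pi_i > \pi_j$ for all $j > i$. A short value of $\pi$ is an entry that is not a right-to-left maximum. -}

module Defs where

open import Data.Nat using (ℕ; suc; _+_; _*_; _∸_; _/_)
open import Data.Nat.Combinatorics using (_C_)
open import Data.Fin using (Fin; _<_)
open import Data.Fin.Properties using (all?; _<?_)
open import Data.Fin.Permutation using (Permutation′; _⟨$⟩ʳ_)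
open import Data.List using (length; filter; allFin)
open import Data.Product using (Σ; _×_; ∃; proj₁)
open import Relation.Nullary using (¬_; ¬?)
open import Relation.Nullary.Decidable using (_→-dec_)
open import Relation.Binary using (Setoid)
open import Relation.Binary.PropositionalEquality using (_≡_; refl; sym; trans)
open import Level using (0ℓ)

-- A permutation π of length n, in one-line notation π₁⋯πₙ : π i = π ⟨$⟩ʳ i.

Contains132 : ∀ {n} → Permutation′ n → Set
Contains132 {n} π =
  Σ (Fin n) λ i → Σ (Fin n) λ j → Σ (Fin n) λ l →
    (i < j) × (j < l) × ((π ⟨$⟩ʳ i) < (π ⟨$⟩ʳ l)) × ((π ⟨$⟩ʳ l) < (π ⟨$⟩ʳ j))

Avoids132 : ∀ {n} → Permutation′ n → Set
Avoids132 π = ¬ Contains132 π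

IsRLMax : ∀ {n} → Permutation′ n → Fin n → Set
IsRLMax {n} π i = ∀ (j : Fin n) → i < j → (π ⟨$⟩ʳ j) < (π ⟨$⟩ʳ i)

isRLMax? : ∀ {n} (π : Permutation′ n) (i : Fin n) → Relation.Nullary.Dec (IsRLMax π i)
isRLMax? π i = all? (λ j → (i <? j) →-dec ((π ⟨$⟩ʳ j) <? (π ⟨$⟩ʳ i)))

shortValues : ∀ {n} → Permutation′ n → ℕ
shortValues {n} π = length (filter (λ i → ¬? (isRLMax? π i)) (allFin n))

A : ℕ → ℕ → Setoid 0ℓ 0ℓ
A n k = record
  { Carrier = Σ (Permutation′ n) (λ π → Avoids132 π × shortValues π ≡ k)
  ; _≈_ = λ p q → ∀ i → proj₁ p ⟨$⟩ʳ i ≡ proj₁ q ⟨$⟩ʳ i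
  ; isEquivalence = record
      { refl = λ i → refl
      ; sym = λ e i → sym (e i)
      ; trans = λ e f i → trans (e i) (f i) } }

-- T_{n,k} = (n-k+1)/(n+1) * binom(n+k, n)  (an exact division for k ≤ n+1)
T : ℕ → ℕ → ℕ
T n k = ((suc n ∸ k) * ((n + k) C n)) / suc n

module Submission where

-- A permutation of length n + 1 is σ′₁ ⋯ σ′ₙ w for a unique permutation σ of length n and
-- last value w, where σ′ᵢ = σᵢ + [σᵢ ≥ w]. For σ avoiding 132, the extension avoids 132 iff
-- w = 0 or w − 1 is the value of a right-to-left maximum of σ; its right-to-left maxima are the
-- last entry and those of σ of value ≥ w, so it has n − g(w) short values, where g(w) counts the
-- latter. Along the admissible w the function g drops by one at a time from g(0) = n − sv(σ) to 0,
-- so the extensions in A(n+1, k) number one if sv(σ) ≤ k ≤ n and none otherwise. Hence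
-- |A(n+1, k)| = Σ_{j ≤ k} |A(n, j)| for k ≤ n, the ballot recurrence of
-- T n k = C(n+k, n) − C(n+k, n+1). An explicit duplicate-free enumeration of all permutations
-- turns the count into a bijection with Fin (T (n − 1) k).

open import Defs
open import Data.Nat using (ℕ; _≥_; _∸_)
open import Data.Fin using (Fin)
open import Function.Bundles using (Inverse)
open import Relation.Binary.PropositionalEquality using (setoid)

open import Data.Empty using (⊥-elim)
open import Data.Fin as F using (zero; suc; toℕ; inject₁; fromℕ; fromℕ<; punchIn)
open import Data.Fin.Permutation
  using (Permutation′; _⟨$⟩ʳ_; _⟨$⟩ˡ_; _≈_; id; inverseʳ; insert; insert-punchIn; remove;
         insert-remove)
open import Data.Fin.Properties as FP
  using (toℕ-inject₁; toℕ-fromℕ; toℕ-fromℕ<; toℕ-injective; toℕ<n; inject₁ℕ<; ≤fromℕ;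
         punchIn-injective; punchIn-mono-≤; punchIn-cancel-≤)
open import Data.Fin.Relation.Unary.Top using (view; ‵fromℕ; ‵inject₁)
open import Data.List using (List; []; _∷_; _++_; map; tabulate; length; filter; allFin; lookup)
open import Data.List.Membership.Propositional.Properties using (∈-lookup)
open import Data.List.Relation.Unary.All as All using (All; []; _∷_)
import Data.List.Relation.Unary.All.Properties as AllP
open import Data.List.Relation.Unary.AllPairs using (AllPairs; []; _∷_)
import Data.List.Relation.Unary.AllPairs.Properties as AllPairsP
open import Data.List.Relation.Unary.Any as Any using (Any; here; there; index)
import Data.List.Relation.Unary.Any.Properties as AnyP
open import Data.List.Relation.Unary.Any.Properties using (lookup-index)
open import Data.List.Properties using (map-++)
open import Data.Nat as ℕ using (zero; suc; _+_; _*_; _≤_; _<_; z≤n; s≤s; _≤?_; _≟_)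
open import Data.Nat.Combinatorics using (_C_; nCn≡1; nC1≡n; k>n⇒nCk≡0; nCk+nC[k+1]≡[n+1]C[k+1])
open import Data.Nat.DivMod using (_/_; m*n/n≡m)
open import Data.Nat.ListAction using (sum)
open import Data.Nat.ListAction.Properties using (sum-++)
open import Data.Nat.Properties
open import Algebra.Properties.Semiring.Sum +-*-semiring
  using (sum-syntax; sum-cong-≗; ∑-distrib-+; *-distribˡ-sum; sum-init-last; sum-replicate-zero)
open import Data.Nat.Tactic.RingSolver using (solve-∀)
open import Data.Product using (Σ; _×_; _,_; proj₁; proj₂; uncurry)
open import Data.Sum using (_⊎_; inj₁; inj₂; [_,_]′)
open import Level using (0ℓ)
open import Relation.Binary using (Setoid; tri<; tri≈; tri>)
open import Function using (_∘_)
open import Function.Bundles using (Injection)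
open import Function.Properties.Inverse using (↔⇒↣)
open import Relation.Binary.PropositionalEquality
  using (_≡_; _≢_; refl; sym; trans; cong; cong₂; subst; subst₂; module ≡-Reasoning)
open import Relation.Nullary using (¬_; Dec; yes; no; ¬?)
open import Relation.Nullary.Decidable using (_×-dec_)
open import Relation.Unary using (Decidable)

private
  variable
    n : ℕ
    P Q X : Set

-- Iverson brackets

𝟙 : Dec P → ℕ
𝟙 (yes _) = 1
𝟙 (no _) = 0

𝟙-yes : (p : Dec P) → P → 𝟙 p ≡ 1
𝟙-yes (yes _) _ = refl
𝟙-yes (no ¬a) a = ⊥-elim (¬a a)

𝟙-no : (p : Dec P) → ¬ P → 𝟙 p ≡ 0
𝟙-no (yes a) ¬a = ⊥-elim (¬a a)
𝟙-no (no _) _ = refl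

𝟙≤1 : (p : Dec P) → 𝟙 p ≤ 1
𝟙≤1 (yes _) = s≤s z≤n
𝟙≤1 (no _) = z≤n

𝟙-positive : (p : Dec P) → 1 ≤ 𝟙 p → P
𝟙-positive (yes a) _ = a
𝟙-positive (no _) ()

𝟙-cong : (p : Dec P) (q : Dec Q) → (P → Q) → (Q → P) → 𝟙 p ≡ 𝟙 q
𝟙-cong (yes _) (yes _) f g = refl
𝟙-cong (yes a) (no b) f g = ⊥-elim (b (f a))
𝟙-cong (no a) (yes b) f g = ⊥-elim (a (g b))
𝟙-cong (no _) (no _) f g = refl

𝟙-×-dec : (p : Dec P) (q : Dec Q) → 𝟙 (p ×-dec q) ≡ 𝟙 p * 𝟙 q
𝟙-×-dec (yes _) (yes _) = refl
𝟙-×-dec (yes _) (no _) = refl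
𝟙-×-dec (no _) (yes _) = refl
𝟙-×-dec (no _) (no _) = refl

𝟙-¬?+𝟙 : (p : Dec P) → 𝟙 (¬? p) + 𝟙 p ≡ 1
𝟙-¬?+𝟙 (yes _) = refl
𝟙-¬?+𝟙 (no _) = refl

≤1⇒≡𝟙 : ∀ x → x ≤ 1 → x ≡ 𝟙 (1 ≤? x)
≤1⇒≡𝟙 zero _ = refl
≤1⇒≡𝟙 (suc zero) _ = refl
≤1⇒≡𝟙 (suc (suc _)) (s≤s ())

𝟙-≟ : ∀ x y → 𝟙 (x ≟ y) ≡ 𝟙 (x ≤? y) * 𝟙 (y ≤? x)
𝟙-≟ x y =
  trans (𝟙-cong (x ≟ y) ((x ≤? y) ×-dec (y ≤? x)) (λ { refl → ≤-refl , ≤-refl }) (uncurry ≤-antisym))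
                (𝟙-×-dec (x ≤? y) (y ≤? x))

𝟙-≤-split : ∀ x y → 𝟙 (x ≤? y) ≡ 𝟙 (suc x ≤? y) + 𝟙 (x ≟ y)
𝟙-≤-split x y with <-cmp x y
... | tri< x<y x≢y _ rewrite 𝟙-yes (x ≤? y) (<⇒≤ x<y) | 𝟙-yes (suc x ≤? y) x<y
                           | 𝟙-no (x ≟ y) x≢y = refl
... | tri≈ _ refl _ rewrite 𝟙-yes (x ≤? x) ≤-refl | 𝟙-no (suc x ≤? x) (n≮n x)
                          | 𝟙-yes (x ≟ x) refl = refl
... | tri> _ x≢y y<x rewrite 𝟙-no (x ≤? y) (<⇒≱ y<x) | 𝟙-no (suc x ≤? y) (<⇒≱ (m<n⇒m<1+n y<x))
                           | 𝟙-no (x ≟ y) x≢y = refl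

𝟙-≤-suc-split : ∀ x k → 𝟙 (x ≤? suc k) ≡ 𝟙 (x ≤? k) + 𝟙 (x ≟ suc k)
𝟙-≤-suc-split x k =
  trans (𝟙-≤-split x (suc k)) (cong (_+ 𝟙 (x ≟ suc k)) (𝟙-cong (suc x ≤? suc k) (x ≤? k) ≤-pred s≤s))

∑-const-1 : ∀ n → ∑[ i < n ] 1 ≡ n
∑-const-1 zero = refl
∑-const-1 (suc n) = cong suc (∑-const-1 n)

∑-𝟙-complement : ∀ n {P Q : Fin n → Set} (P? : Decidable P) (Q? : Decidable Q) →
                 (∀ i → P i → Q i) → (∀ i → Q i → P i) →
                 ∑[ i < n ] 𝟙 (¬? (P? i)) + ∑[ i < n ] 𝟙 (Q? i) ≡ n
∑-𝟙-complement n P? Q? P⇒Q Q⇒P = begin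
    ∑[ i < n ] 𝟙 (¬? (P? i)) + ∑[ i < n ] 𝟙 (Q? i)  ≡⟨ sym (∑-distrib-+ {n} _ _) ⟩
    ∑[ i < n ] (𝟙 (¬? (P? i)) + 𝟙 (Q? i))           ≡⟨ sum-cong-≗ {n} 𝟙¬?+𝟙≡1 ⟩
    ∑[ i < n ] 1                                     ≡⟨ ∑-const-1 n ⟩
    n                                                ∎
  where
  open ≡-Reasoning
  𝟙¬?+𝟙≡1 : ∀ i → 𝟙 (¬? (P? i)) + 𝟙 (Q? i) ≡ 1
  𝟙¬?+𝟙≡1 i =
    trans (cong (𝟙 (¬? (P? i)) +_) (𝟙-cong (Q? i) (P? i) (Q⇒P i) (P⇒Q i))) (𝟙-¬?+𝟙 (P? i))

∑-zero : ∀ n (f : Fin n → ℕ) → (∀ i → f i ≡ 0) → ∑[ i < n ] f i ≡ 0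
∑-zero n f f≡0 = trans (sum-cong-≗ f≡0) (sum-replicate-zero n)

∑-toℕ-last : ∀ m (f : ℕ → ℕ) → ∑[ i < suc m ] f (toℕ i) ≡ ∑[ i < m ] f (toℕ i) + f m
∑-toℕ-last m f = trans (sum-init-last {m} (f ∘ toℕ))
  (cong₂ _+_ (sum-cong-≗ {m} (cong f ∘ toℕ-inject₁)) (cong f (toℕ-fromℕ m)))

∑-positive⁺ : ∀ n (f : Fin n → ℕ) i → 1 ≤ f i → 1 ≤ ∑[ j < n ] f j
∑-positive⁺ (suc n) f zero p = ≤-trans p (m≤m+n (f zero) _)
∑-positive⁺ (suc n) f (suc i) p = ≤-trans (∑-positive⁺ n (f ∘ suc) i p) (m≤n+m _ (f zero))

∑-positive⁻ : ∀ n (f : Fin n → ℕ) → 1 ≤ ∑[ i < n ] f i → Σ (Fin n) λ i → 1 ≤ f i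
∑-positive⁻ (suc n) f p with f zero in eq
... | suc _ = zero , subst (1 ≤_) (sym eq) (s≤s z≤n)
... | zero with ∑-positive⁻ n (f ∘ suc) p
...   | i , q = suc i , q

∑-≤1 : ∀ n (f : Fin n → ℕ) → (∀ i → f i ≤ 1) →
       (∀ i j → 1 ≤ f i → 1 ≤ f j → i ≡ j) →
       ∑[ i < n ] f i ≤ 1
∑-≤1 zero f f≤1 unique = z≤n
∑-≤1 (suc n) f f≤1 unique with f zero in eq | f≤1 zero
... | zero | _ = ∑-≤1 n (f ∘ suc) (f≤1 ∘ suc) (λ i j p q → FP.suc-injective (unique (suc i) (suc j) p q))
... | suc zero | _ = ≤-reflexive (cong suc (∑-zero n (f ∘ suc) rest≡0))
  where
  rest≡0 : ∀ i → f (suc i) ≡ 0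
  rest≡0 i with f (suc i) in eq′
  ... | zero = refl
  ... | suc _ with () ← unique zero (suc i) (≤-reflexive (sym eq)) (subst (1 ≤_) (sym eq′) (s≤s z≤n))
... | suc (suc _) | s≤s ()

sum-map-++ : ∀ (f : X → ℕ) xs ys → sum (map f (xs ++ ys)) ≡ sum (map f xs) + sum (map f ys)
sum-map-++ f xs ys = trans (cong sum (map-++ f xs ys)) (sum-++ (map f xs) (map f ys))

sum-map-tabulate : ∀ n (g : Fin n → X) (f : X → ℕ) → sum (map f (tabulate g)) ≡ ∑[ i < n ] f (g i)
sum-map-tabulate zero g f = refl
sum-map-tabulate (suc n) g f = cong (f (g zero) +_) (sum-map-tabulate n (g ∘ suc) f)

sum-map-cong : ∀ (xs : List X) {f g : X → ℕ} → (∀ x → f x ≡ g x) → sum (map f xs) ≡ sum (map g xs)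
sum-map-cong [] e = refl
sum-map-cong (x ∷ xs) e = cong₂ _+_ (e x) (sum-map-cong xs e)

sum-map-+ : ∀ (xs : List X) (f g : X → ℕ) →
            sum (map (λ x → f x + g x) xs) ≡ sum (map f xs) + sum (map g xs)
sum-map-+ [] f g = refl
sum-map-+ (x ∷ xs) f g = trans (cong (f x + g x +_) (sum-map-+ xs f g)) (interchange (f x) (g x) _ _)
  where
  interchange : ∀ a b c d → a + b + (c + d) ≡ a + c + (b + d)
  interchange = solve-∀

sum-map-*ˡ : ∀ (xs : List X) c (f : X → ℕ) → sum (map (λ x → c * f x) xs) ≡ c * sum (map f xs)
sum-map-*ˡ [] c f = sym (*-zeroʳ c)
sum-map-*ˡ (x ∷ xs) c f = trans (cong (c * f x +_) (sum-map-*ˡ xs c f)) (sym (*-distribˡ-+ c (f x) _))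

length-filter≡sum-𝟙 : ∀ {X : Set} {P : X → Set} (P? : Decidable P) xs →
                      length (filter P? xs) ≡ sum (map (𝟙 ∘ P?) xs)
length-filter≡sum-𝟙 P? [] = refl
length-filter≡sum-𝟙 P? (x ∷ xs) with P? x
... | yes _ = cong suc (length-filter≡sum-𝟙 P? xs)
... | no _ = length-filter≡sum-𝟙 P? xs

module _ {P : X → Set} (P? : Decidable P) where

  filterΣ : List X → List (Σ X P)
  filterΣ [] = []
  filterΣ (x ∷ xs) with P? x
  ... | yes px = (x , px) ∷ filterΣ xs
  ... | no _ = filterΣ xs

  length-filterΣ : ∀ xs → length (filterΣ xs) ≡ length (filter P? xs)
  length-filterΣ [] = refl
  length-filterΣ (x ∷ xs) with P? x
  ... | yes _ = cong suc (length-filterΣ xs)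
  ... | no _ = length-filterΣ xs

  module _ (R : X → X → Set) where

    filterΣ-complete : (∀ {x y} → R x y → P x → P y) → ∀ (x : Σ X P) xs → Any (R (proj₁ x)) xs →
                       Any (λ y → R (proj₁ x) (proj₁ y)) (filterΣ xs)
    filterΣ-complete resp x (y ∷ xs) x∈ with P? y | x∈
    ... | yes _ | here x≈y = here x≈y
    ... | yes _ | there x∈xs = there (filterΣ-complete resp x xs x∈xs)
    ... | no ¬py | here x≈y = ⊥-elim (¬py (resp x≈y (proj₂ x)))
    ... | no _ | there x∈xs = filterΣ-complete resp x xs x∈xs

    filterΣ-all : ∀ {x} xs → All (R x) xs → All (λ y → R x (proj₁ y)) (filterΣ xs)
    filterΣ-all [] [] = []
    filterΣ-all (y ∷ xs) (r ∷ rs) with P? y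
    ... | yes _ = r ∷ filterΣ-all xs rs
    ... | no _ = filterΣ-all xs rs

    filterΣ-pairwise : ∀ xs → AllPairs R xs → AllPairs (λ a b → R (proj₁ a) (proj₁ b)) (filterΣ xs)
    filterΣ-pairwise [] [] = []
    filterΣ-pairwise (y ∷ xs) (r ∷ rs) with P? y
    ... | yes _ = filterΣ-all xs r ∷ filterΣ-pairwise xs rs
    ... | no _ = filterΣ-pairwise xs rs

module _ (S : Setoid 0ℓ 0ℓ) where

  open Setoid S
    renaming (Carrier to C; _≈_ to _≈ₛ_; refl to ≈ₛ-refl; sym to ≈ₛ-sym; trans to ≈ₛ-trans)
  open import Data.List.Relation.Unary.Enumerates.Setoid S using (IsEnumeration)
  open import Data.List.Relation.Unary.Unique.Setoid S using (Unique)

  lookup-injective : ∀ {xs} → Unique xs → ∀ i j → lookup xs i ≈ₛ lookup xs j → i ≡ j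
  lookup-injective (_ ∷ _) zero zero _ = refl
  lookup-injective (x≉xs ∷ _) zero (suc j) x≈ = ⊥-elim (All.lookup x≉xs (∈-lookup j) x≈)
  lookup-injective (x≉xs ∷ _) (suc i) zero ≈x = ⊥-elim (All.lookup x≉xs (∈-lookup i) (≈ₛ-sym ≈x))
  lookup-injective (_ ∷ xs!) (suc i) (suc j) e = cong suc (lookup-injective xs! i j e)

  enumeration⇒↔Fin : ∀ xs → IsEnumeration xs → Unique xs → Inverse S (setoid (Fin (length xs)))
  enumeration⇒↔Fin xs _∈xs xs! = record
    { to = position
    ; from = lookup xs
    ; to-cong = λ {x} {y} x≈y →
        lookup-injective xs! _ _ (≈ₛ-trans (≈ₛ-sym (at x)) (≈ₛ-trans x≈y (at y)))
    ; from-cong = λ { refl → ≈ₛ-refl }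
    ; inverse = (λ {_} {x} x≈ → lookup-injective xs! _ _ (≈ₛ-trans (≈ₛ-sym (at x)) x≈))
              , (λ { {x} refl → ≈ₛ-sym (at x) })
    }
    where
    position : C → Fin (length xs)
    position x = index (x ∈xs)
    at : ∀ x → x ≈ₛ lookup xs (position x)
    at x = lookup-index (x ∈xs)

-- Ballot numbers

pascal : ∀ m r → suc m C suc r ≡ m C r + m C suc r
pascal m r = sym (nCk+nC[k+1]≡[n+1]C[k+1] m r)

[r+1]*mC[r+1]+r*mCr≡m*mCr : ∀ m r → suc r * (m C suc r) + r * (m C r) ≡ m * (m C r)
[r+1]*mC[r+1]+r*mCr≡m*mCr zero zero = refl
[r+1]*mC[r+1]+r*mCr≡m*mCr zero (suc r) = cong₂ _+_ (*-zeroʳ (suc (suc r))) (*-zeroʳ (suc r))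
[r+1]*mC[r+1]+r*mCr≡m*mCr (suc m) zero =
  trans (+-identityʳ _) (trans (*-identityˡ _) (trans (nC1≡n (suc m)) (sym (*-identityʳ _))))
[r+1]*mC[r+1]+r*mCr≡m*mCr (suc m) (suc r) = begin
    (2 + r) * (suc m C suc (suc r)) + (1 + r) * (suc m C suc r)
      ≡⟨ cong₂ (λ x y → (2 + r) * x + (1 + r) * y) (pascal m (suc r)) (pascal m r) ⟩
    (2 + r) * (a + b) + (1 + r) * (c + a)
      ≡⟨ regroup₁ r a b c ⟩
    (2 + r) * a + ((2 + r) * b + (1 + r) * a) + (1 + r) * c
      ≡⟨ cong (λ z → (2 + r) * a + z + (1 + r) * c) ([r+1]*mC[r+1]+r*mCr≡m*mCr m (suc r)) ⟩
    (2 + r) * a + m * a + (1 + r) * c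
      ≡⟨ regroup₂ r a c m ⟩
    ((1 + r) * a + r * c) + c + (1 + m) * a
      ≡⟨ cong (λ z → z + c + (1 + m) * a) ([r+1]*mC[r+1]+r*mCr≡m*mCr m r) ⟩
    m * c + c + (1 + m) * a
      ≡⟨ regroup₃ m a c ⟩
    (1 + m) * (c + a)
      ≡⟨ cong (suc m *_) (sym (pascal m r)) ⟩
    suc m * (suc m C suc r) ∎
  where
  open ≡-Reasoning
  a = m C suc r
  b = m C suc (suc r)
  c = m C r
  regroup₁ : ∀ r a b c → (2 + r) * (a + b) + (1 + r) * (c + a) ≡
                         (2 + r) * a + ((2 + r) * b + (1 + r) * a) + (1 + r) * c
  regroup₁ = solve-∀
  regroup₂ : ∀ r a c m → (2 + r) * a + m * a + (1 + r) * c ≡ ((1 + r) * a + r * c) + c + (1 + m) * a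
  regroup₂ = solve-∀
  regroup₃ : ∀ m a c → m * c + c + (1 + m) * a ≡ (1 + m) * (c + a)
  regroup₃ = solve-∀

[n+1]*[n+k]C[n+1]≡k*[n+k]Cn : ∀ n k → suc n * ((n + k) C suc n) ≡ k * ((n + k) C n)
[n+1]*[n+k]C[n+1]≡k*[n+k]Cn n k = +-cancelʳ-≡ (n * c) _ _ (begin
    suc n * ((n + k) C suc n) + n * c ≡⟨ [r+1]*mC[r+1]+r*mCr≡m*mCr (n + k) n ⟩
    (n + k) * c                       ≡⟨ *-distribʳ-+ c n k ⟩
    n * c + k * c                     ≡⟨ +-comm (n * c) (k * c) ⟩
    k * c + n * c                     ∎)
  where
  open ≡-Reasoning
  c = (n + k) C n

-- For k ≤ n + 1 the division in T is exact and T n k = C(n+k, n) − C(n+k, n+1).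
T+[n+k]C[n+1]≡[n+k]Cn : ∀ n k → k ≤ suc n → T n k + (n + k) C suc n ≡ (n + k) C n
T+[n+k]C[n+1]≡[n+k]Cn n k k≤1+n = trans (cong (_+ c′) T≡c∸c′) (m∸n+n≡m c′≤c)
  where
  open ≡-Reasoning
  c = (n + k) C n
  c′ = (n + k) C suc n
  c′≤c : c′ ≤ c
  c′≤c = *-cancelˡ-≤ (suc n)
    (≤-trans (≤-reflexive ([n+1]*[n+k]C[n+1]≡k*[n+k]Cn n k)) (*-monoˡ-≤ c k≤1+n))
  T≡c∸c′ : T n k ≡ c ∸ c′
  T≡c∸c′ = begin
    ((suc n ∸ k) * c) / suc n         ≡⟨ cong (_/ suc n) (*-distribʳ-∸ c (suc n) k) ⟩
    (suc n * c ∸ k * c) / suc n       ≡⟨ cong (λ z → (suc n * c ∸ z) / suc n)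
                                              (sym ([n+1]*[n+k]C[n+1]≡k*[n+k]Cn n k)) ⟩
    (suc n * c ∸ suc n * c′) / suc n  ≡⟨ cong (_/ suc n) (sym (*-distribˡ-∸ (suc n) c c′)) ⟩
    (suc n * (c ∸ c′)) / suc n        ≡⟨ cong (_/ suc n) (*-comm (suc n) (c ∸ c′)) ⟩
    ((c ∸ c′) * suc n) / suc n        ≡⟨ m*n/n≡m (c ∸ c′) (suc n) ⟩
    c ∸ c′                            ∎

T[n,0]≡1 : ∀ n → T n 0 ≡ 1
T[n,0]≡1 n = begin
    T n 0                           ≡⟨ sym (+-identityʳ (T n 0)) ⟩
    T n 0 + 0                       ≡⟨ cong (T n 0 +_) (sym (k>n⇒nCk≡0 n+0<1+n)) ⟩
    T n 0 + (n + 0) C suc n         ≡⟨ T+[n+k]C[n+1]≡[n+k]Cn n 0 z≤n ⟩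
    (n + 0) C n                     ≡⟨ cong (_C n) (+-identityʳ n) ⟩
    n C n                           ≡⟨ nCn≡1 n ⟩
    1                               ∎
  where
  open ≡-Reasoning
  n+0<1+n : n + 0 < suc n
  n+0<1+n = subst (_< suc n) (sym (+-identityʳ n)) ≤-refl

T[n,k]≡0 : ∀ n k → suc n ≤ k → T n k ≡ 0
T[n,k]≡0 n k 1+n≤k rewrite m≤n⇒m∸n≡0 1+n≤k = refl

T-recurrence : ∀ n k → k ≤ n → T (suc n) (suc k) ≡ T (suc n) k + T n (suc k)
T-recurrence n k k≤n = +-cancelʳ-≡ (c₁ + c₂) _ _ (begin
    T (suc n) (suc k) + (c₁ + c₂)         ≡⟨ T+c₁+c₂≡c₀+c₁ ⟩
    c₀ + c₁                               ≡⟨ cong (_+ c₁) (sym T+c₁≡c₀) ⟩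
    (T n (suc k) + c₁) + c₁               ≡⟨ cong ((T n (suc k) + c₁) +_) (sym T+c₂≡c₁) ⟩
    (T n (suc k) + c₁) + (T (suc n) k + c₂) ≡⟨ regroup (T n (suc k)) c₁ (T (suc n) k) c₂ ⟩
    (T (suc n) k + T n (suc k)) + (c₁ + c₂) ∎)
  where
  open ≡-Reasoning
  m = suc (n + k)
  c₀ = m C n
  c₁ = m C suc n
  c₂ = m C suc (suc n)
  T+c₂≡c₁ : T (suc n) k + c₂ ≡ c₁
  T+c₂≡c₁ = T+[n+k]C[n+1]≡[n+k]Cn (suc n) k (m≤n⇒m≤1+n (m≤n⇒m≤1+n k≤n))
  T+c₁≡c₀ : T n (suc k) + c₁ ≡ c₀
  T+c₁≡c₀ = subst (λ z → T n (suc k) + z C suc n ≡ z C n) (+-suc n k)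
              (T+[n+k]C[n+1]≡[n+k]Cn n (suc k) (s≤s k≤n))
  T+c₁+c₂≡c₀+c₁ : T (suc n) (suc k) + (c₁ + c₂) ≡ c₀ + c₁
  T+c₁+c₂≡c₀+c₁ = subst₂ (λ x y → T (suc n) (suc k) + x ≡ y) (pascal m (suc n)) (pascal m n)
                    (subst (λ z → T (suc n) (suc k) + suc z C suc (suc n) ≡ suc z C suc n) (+-suc n k)
                      (T+[n+k]C[n+1]≡[n+k]Cn (suc n) (suc k) (s≤s (m≤n⇒m≤1+n k≤n))))
  regroup : ∀ a b c d → (a + b) + (c + d) ≡ (c + a) + (b + d)
  regroup = solve-∀

∑[j≤k]T[n,j]≡T[n+1,k] : ∀ n k → k ≤ suc n → ∑[ j < suc k ] T n (toℕ j) ≡ T (suc n) k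
∑[j≤k]T[n,j]≡T[n+1,k] n zero _ = trans (+-identityʳ (T n 0)) (trans (T[n,0]≡1 n) (sym (T[n,0]≡1 (suc n))))
∑[j≤k]T[n,j]≡T[n+1,k] n (suc k) (s≤s k≤n) = begin
    ∑[ j < suc (suc k) ] T n (toℕ j)     ≡⟨ ∑-toℕ-last (suc k) (T n) ⟩
    ∑[ j < suc k ] T n (toℕ j) + T n (suc k)
      ≡⟨ cong (_+ T n (suc k)) (∑[j≤k]T[n,j]≡T[n+1,k] n k (m≤n⇒m≤1+n k≤n)) ⟩
    T (suc n) k + T n (suc k)            ≡⟨ sym (T-recurrence n k k≤n) ⟩
    T (suc n) (suc k)                    ∎
  where open ≡-Reasoning

-- Levels hit by a function decreasing in unit steps

𝟙-unit-step : ∀ x n G → x ≤ G →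
              𝟙 (suc x ≤? n) * 𝟙 (n ≤? G) + 𝟙 (x ≟ n) ≡ 𝟙 (x ≤? n) * 𝟙 (n ≤? G)
𝟙-unit-step x n G x≤G = sym (begin
    𝟙 (x ≤? n) * 𝟙 (n ≤? G)
      ≡⟨ cong (_* 𝟙 (n ≤? G)) (𝟙-≤-split x n) ⟩
    (𝟙 (suc x ≤? n) + 𝟙 (x ≟ n)) * 𝟙 (n ≤? G)
      ≡⟨ *-distribʳ-+ (𝟙 (n ≤? G)) (𝟙 (suc x ≤? n)) _ ⟩
    𝟙 (suc x ≤? n) * 𝟙 (n ≤? G) + 𝟙 (x ≟ n) * 𝟙 (n ≤? G)
      ≡⟨ cong (𝟙 (suc x ≤? n) * 𝟙 (n ≤? G) +_) (sym (𝟙-×-dec (x ≟ n) (n ≤? G))) ⟩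
    𝟙 (suc x ≤? n) * 𝟙 (n ≤? G) + 𝟙 ((x ≟ n) ×-dec (n ≤? G))
      ≡⟨ cong (𝟙 (suc x ≤? n) * 𝟙 (n ≤? G) +_) (𝟙-cong _ (x ≟ n) proj₁ λ { refl → refl , x≤G }) ⟩
    𝟙 (suc x ≤? n) * 𝟙 (n ≤? G) + 𝟙 (x ≟ n) ∎)
  where open ≡-Reasoning

-- afterDrop d marks W = 0 and every W just after a unit drop, i.e. with d (W − 1) = 1.
afterDrop : (ℕ → ℕ) → ℕ → ℕ
afterDrop d zero = 1
afterDrop d (suc M) = d M

module _ (g d : ℕ → ℕ) (g-step : ∀ m → g m ≡ g (suc m) + d m) (d≤1 : ∀ m → d m ≤ 1) where

  g≤g0 : ∀ m → g m ≤ g 0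
  g≤g0 zero = ≤-refl
  g≤g0 (suc m) = ≤-trans (≤-trans (m≤m+n (g (suc m)) (d m)) (≤-reflexive (sym (g-step m)))) (g≤g0 m)

  ∑-afterDrop-prefix : ∀ n k M → ∑[ W < suc M ] (afterDrop d (toℕ W) * 𝟙 (g (toℕ W) + k ≟ n))
                                 ≡ 𝟙 (g M + k ≤? n) * 𝟙 (n ≤? g 0 + k)
  ∑-afterDrop-prefix n k zero = trans (+-identityʳ _) (trans (+-identityʳ _) (𝟙-≟ (g 0 + k) n))
  ∑-afterDrop-prefix n k (suc M) = begin
      ∑[ W < suc (suc M) ] hit (toℕ W)                  ≡⟨ ∑-toℕ-last (suc M) hit ⟩
      ∑[ W < suc M ] hit (toℕ W) + hit (suc M)          ≡⟨ cong (_+ hit (suc M)) (∑-afterDrop-prefix n k M) ⟩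
      𝟙 (g M + k ≤? n) * 𝟙 (n ≤? G) + d M * 𝟙 (x ≟ n)  ≡⟨ drop-step (d M) refl (d≤1 M) ⟩
      𝟙 (x ≤? n) * 𝟙 (n ≤? G)                          ∎
    where
    open ≡-Reasoning
    hit : ℕ → ℕ
    hit W = afterDrop d W * 𝟙 (g W + k ≟ n)
    G = g 0 + k
    x = g (suc M) + k
    drop-step : ∀ δ → d M ≡ δ → δ ≤ 1 →
                𝟙 (g M + k ≤? n) * 𝟙 (n ≤? G) + δ * 𝟙 (x ≟ n) ≡ 𝟙 (x ≤? n) * 𝟙 (n ≤? G)
    drop-step zero dM≡0 _ =
      trans (+-identityʳ _) (cong (λ z → 𝟙 (z + k ≤? n) * 𝟙 (n ≤? G)) gM≡g[1+M])
      where
      gM≡g[1+M] : g M ≡ g (suc M)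
      gM≡g[1+M] = trans (g-step M) (trans (cong (g (suc M) +_) dM≡0) (+-identityʳ _))
    drop-step (suc zero) dM≡1 _ =
      trans (cong₂ _+_ (cong (λ z → 𝟙 (z ≤? n) * 𝟙 (n ≤? G)) gM+k≡1+x) (*-identityˡ _))
            (𝟙-unit-step x n G (+-monoˡ-≤ k (g≤g0 (suc M))))
      where
      gM+k≡1+x : g M + k ≡ suc x
      gM+k≡1+x = trans (cong (_+ k) (trans (g-step M) (cong (g (suc M) +_) dM≡1)))
                       (trans (+-assoc (g (suc M)) 1 k) (+-suc (g (suc M)) k))
    drop-step (suc (suc _)) _ (s≤s ())

  -- Every level n − k between g n = 0 and g 0 is attained at exactly one marked W ≤ n.
  ∑-afterDrop-level : ∀ n k → g n ≡ 0 →
                      ∑[ W < suc n ] (afterDrop d (toℕ W) * 𝟙 (g (toℕ W) + k ≟ n))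
                      ≡ 𝟙 (k ≤? n) * 𝟙 (n ≤? g 0 + k)
  ∑-afterDrop-level n k gn≡0 =
    trans (∑-afterDrop-prefix n k n) (cong (λ z → 𝟙 (z + k ≤? n) * 𝟙 (n ≤? g 0 + k)) gn≡0)

-- Appending a last entry to a permutation

permutation-injective : ∀ (σ : Permutation′ n) {i j} → σ ⟨$⟩ʳ i ≡ σ ⟨$⟩ʳ j → i ≡ j
permutation-injective σ = Injection.injective (↔⇒↣ σ)

punchIn-below : ∀ (w : Fin (suc n)) x → x F.< w → punchIn w x F.< w
punchIn-below (suc w) zero _ = s≤s z≤n
punchIn-below (suc w) (suc x) (s≤s x<w) = s≤s (punchIn-below w x x<w)

punchIn-above : ∀ (w : Fin (suc n)) x → w F.≤ x → w F.< punchIn w x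
punchIn-above zero x _ = s≤s z≤n
punchIn-above (suc w) (suc x) (s≤s w≤x) = s≤s (punchIn-above w x w≤x)

punchIn-below⁻ : ∀ (w : Fin (suc n)) x → punchIn w x F.< w → x F.< w
punchIn-below⁻ w x p = ≰⇒> (λ w≤x → <-asym p (punchIn-above w x w≤x))

punchIn-above⁻ : ∀ (w : Fin (suc n)) x → w F.< punchIn w x → w F.≤ x
punchIn-above⁻ w x p = ≮⇒≥ (λ x<w → <-asym p (punchIn-below w x x<w))

punchIn-mono-< : ∀ (w : Fin (suc n)) x y → x F.< y → punchIn w x F.< punchIn w y
punchIn-mono-< w x y x<y = ≰⇒> (λ py≤px → <⇒≱ x<y (punchIn-cancel-≤ w y x py≤px))

punchIn-cancel-< : ∀ (w : Fin (suc n)) x y → punchIn w x F.< punchIn w y → x F.< y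
punchIn-cancel-< w x y p = ≰⇒> (λ y≤x → <⇒≱ p (punchIn-mono-≤ w y x y≤x))

punchIn-fromℕ : ∀ n (q : Fin n) → punchIn (fromℕ n) q ≡ inject₁ q
punchIn-fromℕ (suc n) zero = refl
punchIn-fromℕ (suc n) (suc q) = cong suc (punchIn-fromℕ n q)

inject₁-mono-< : ∀ {i j : Fin n} → i F.< j → inject₁ i F.< inject₁ j
inject₁-mono-< {i = i} {j} = subst₂ ℕ._<_ (sym (toℕ-inject₁ i)) (sym (toℕ-inject₁ j))

inject₁-cancel-< : ∀ {i j : Fin n} → inject₁ i F.< inject₁ j → i F.< j
inject₁-cancel-< {i = i} {j} = subst₂ ℕ._<_ (toℕ-inject₁ i) (toℕ-inject₁ j)

inject₁<fromℕ : ∀ (q : Fin n) → inject₁ q F.< fromℕ n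
inject₁<fromℕ {n} q = subst (toℕ (inject₁ q) <_) (sym (toℕ-fromℕ n)) (inject₁ℕ< q)

fromℕ≮ : ∀ (j : Fin (suc n)) → ¬ fromℕ n F.< j
fromℕ≮ j = ≤⇒≯ (≤fromℕ j)

-- extend σ w has one-line notation σ′₁ ⋯ σ′ₙ w, where σ′ᵢ = σᵢ if σᵢ < w and σ′ᵢ = σᵢ + 1
-- otherwise.
extend : Permutation′ n → Fin (suc n) → Permutation′ (suc n)
extend {n} σ w = insert (fromℕ n) w σ

module _ (σ : Permutation′ n) (w : Fin (suc n)) where

  private
    π = extend σ w

  extend-last : π ⟨$⟩ʳ fromℕ n ≡ w
  extend-last with fromℕ n F.≟ fromℕ n
  ... | yes _ = refl
  ... | no n≢n = ⊥-elim (n≢n refl)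

  extend-inject₁ : ∀ q → π ⟨$⟩ʳ inject₁ q ≡ punchIn w (σ ⟨$⟩ʳ q)
  extend-inject₁ q = subst (λ i → π ⟨$⟩ʳ i ≡ punchIn w (σ ⟨$⟩ʳ q)) (punchIn-fromℕ n q)
                       (insert-punchIn (fromℕ n) w σ q)

  extend-mono-< : ∀ a c → σ ⟨$⟩ʳ a F.< σ ⟨$⟩ʳ c →
                  π ⟨$⟩ʳ inject₁ a F.< π ⟨$⟩ʳ inject₁ c
  extend-mono-< a c p rewrite extend-inject₁ a | extend-inject₁ c = punchIn-mono-< w _ _ p

  extend-cancel-< : ∀ a c → π ⟨$⟩ʳ inject₁ a F.< π ⟨$⟩ʳ inject₁ c →
                    σ ⟨$⟩ʳ a F.< σ ⟨$⟩ʳ c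
  extend-cancel-< a c p rewrite extend-inject₁ a | extend-inject₁ c = punchIn-cancel-< w _ _ p

  extend-below-last : ∀ a → σ ⟨$⟩ʳ a F.< w → π ⟨$⟩ʳ inject₁ a F.< π ⟨$⟩ʳ fromℕ n
  extend-below-last a p rewrite extend-inject₁ a | extend-last = punchIn-below w _ p

  extend-above-last : ∀ a → w F.≤ σ ⟨$⟩ʳ a → π ⟨$⟩ʳ fromℕ n F.< π ⟨$⟩ʳ inject₁ a
  extend-above-last a p rewrite extend-inject₁ a | extend-last = punchIn-above w _ p

  extend-below-last⁻ : ∀ a → π ⟨$⟩ʳ inject₁ a F.< π ⟨$⟩ʳ fromℕ n → σ ⟨$⟩ʳ a F.< w
  extend-below-last⁻ a p rewrite extend-inject₁ a | extend-last = punchIn-below⁻ w _ p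

  extend-above-last⁻ : ∀ a → π ⟨$⟩ʳ fromℕ n F.< π ⟨$⟩ʳ inject₁ a → w F.≤ σ ⟨$⟩ʳ a
  extend-above-last⁻ a p rewrite extend-inject₁ a | extend-last = punchIn-above⁻ w _ p

  isRLMax-extend-last : IsRLMax π (fromℕ n)
  isRLMax-extend-last j n<j = ⊥-elim (fromℕ≮ j n<j)

  isRLMax-extend⁻ : ∀ q → IsRLMax π (inject₁ q) → IsRLMax σ q × w F.≤ σ ⟨$⟩ʳ q
  isRLMax-extend⁻ q max = (λ j q<j → extend-cancel-< j q (max (inject₁ j) (inject₁-mono-< q<j)))
                        , extend-above-last⁻ q (max (fromℕ n) (inject₁<fromℕ q))

  isRLMax-extend⁺ : ∀ q → IsRLMax σ q → w F.≤ σ ⟨$⟩ʳ q → IsRLMax π (inject₁ q)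
  isRLMax-extend⁺ q max w≤σq j q<j with view j
  ... | ‵fromℕ = extend-above-last q w≤σq
  ... | ‵inject₁ j′ = extend-mono-< j′ q (max j′ (inject₁-cancel-< q<j))

extend-cong : ∀ {σ τ : Permutation′ n} w → σ ≈ τ → extend σ w ≈ extend τ w
extend-cong {σ = σ} {τ} w σ≈τ i with view i
... | ‵fromℕ = trans (extend-last σ w) (sym (extend-last τ w))
... | ‵inject₁ q =
  trans (extend-inject₁ σ w q) (trans (cong (punchIn w) (σ≈τ q)) (sym (extend-inject₁ τ w q)))

extend-injective : ∀ {σ τ : Permutation′ n} {w w′} →
                   extend σ w ≈ extend τ w′ → σ ≈ τ × w ≡ w′
extend-injective {n} {σ} {τ} {w} {w′} e = σ≈τ , w≡w′
  where
  w≡w′ : w ≡ w′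
  w≡w′ = trans (sym (extend-last σ w)) (trans (e (fromℕ n)) (extend-last τ w′))
  σ≈τ : σ ≈ τ
  σ≈τ q = punchIn-injective w _ _ (begin
    punchIn w (σ ⟨$⟩ʳ q)        ≡⟨ sym (extend-inject₁ σ w q) ⟩
    extend σ w ⟨$⟩ʳ inject₁ q   ≡⟨ e (inject₁ q) ⟩
    extend τ w′ ⟨$⟩ʳ inject₁ q  ≡⟨ extend-inject₁ τ w′ q ⟩
    punchIn w′ (τ ⟨$⟩ʳ q)       ≡⟨ cong (λ v → punchIn v (τ ⟨$⟩ʳ q)) (sym w≡w′) ⟩
    punchIn w (τ ⟨$⟩ʳ q)        ∎)
    where open ≡-Reasoning

shortValues≡∑ : ∀ (π : Permutation′ n) → shortValues π ≡ ∑[ i < n ] 𝟙 (¬? (isRLMax? π i))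
shortValues≡∑ {n} π = trans (length-filter≡sum-𝟙 (λ i → ¬? (isRLMax? π i)) (allFin n))
                            (sum-map-tabulate n (λ i → i) _)

rlMaxesFrom : Permutation′ n → ℕ → ℕ
rlMaxesFrom {n} σ W = ∑[ q < n ] 𝟙 (isRLMax? σ q ×-dec (W ≤? toℕ (σ ⟨$⟩ʳ q)))

rlMaxesAt : Permutation′ n → ℕ → ℕ
rlMaxesAt {n} σ M = ∑[ q < n ] 𝟙 (isRLMax? σ q ×-dec (M ≟ toℕ (σ ⟨$⟩ʳ q)))

shortValues+rlMaxesFrom0 : ∀ (σ : Permutation′ n) → shortValues σ + rlMaxesFrom σ 0 ≡ n
shortValues+rlMaxesFrom0 {n} σ = trans (cong (_+ rlMaxesFrom σ 0) (shortValues≡∑ σ))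
  (∑-𝟙-complement n (isRLMax? σ) (λ q → isRLMax? σ q ×-dec (0 ≤? toℕ (σ ⟨$⟩ʳ q)))
                    (λ _ → _, z≤n) (λ _ → proj₁))

shortValues-extend : ∀ (σ : Permutation′ n) w → shortValues (extend σ w) + rlMaxesFrom σ (toℕ w) ≡ n
shortValues-extend {n} σ w = begin
    shortValues π + rlMaxesFrom σ (toℕ w)
      ≡⟨ cong (_+ rlMaxesFrom σ (toℕ w)) (trans (shortValues≡∑ π) (sum-init-last {n} short)) ⟩
    (∑[ q < n ] short (inject₁ q) + short (fromℕ n)) + rlMaxesFrom σ (toℕ w)
      ≡⟨ cong (λ z → (∑[ q < n ] short (inject₁ q) + z) + rlMaxesFrom σ (toℕ w)) last-not-short ⟩
    (∑[ q < n ] short (inject₁ q) + 0) + rlMaxesFrom σ (toℕ w)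
      ≡⟨ cong (_+ rlMaxesFrom σ (toℕ w)) (+-identityʳ _) ⟩
    ∑[ q < n ] short (inject₁ q) + rlMaxesFrom σ (toℕ w)
      ≡⟨ ∑-𝟙-complement n (isRLMax? π ∘ inject₁)
                          (λ q → isRLMax? σ q ×-dec (toℕ w ≤? toℕ (σ ⟨$⟩ʳ q)))
                          (isRLMax-extend⁻ σ w) (λ q → uncurry (isRLMax-extend⁺ σ w q)) ⟩
    n ∎
  where
  open ≡-Reasoning
  π = extend σ w
  short : Fin (suc n) → ℕ
  short i = 𝟙 (¬? (isRLMax? π i))
  last-not-short : short (fromℕ n) ≡ 0
  last-not-short = 𝟙-no (¬? (isRLMax? π (fromℕ n))) (λ ¬max → ¬max (isRLMax-extend-last σ w))

rlMaxesFrom-step : ∀ (σ : Permutation′ n) M → rlMaxesFrom σ M ≡ rlMaxesFrom σ (suc M) + rlMaxesAt σ M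
rlMaxesFrom-step {n} σ M = trans (sum-cong-≗ {n} split) (∑-distrib-+ {n} _ _)
  where
  split : ∀ q → 𝟙 (isRLMax? σ q ×-dec (M ≤? toℕ (σ ⟨$⟩ʳ q)))
              ≡ 𝟙 (isRLMax? σ q ×-dec (suc M ≤? toℕ (σ ⟨$⟩ʳ q)))
                + 𝟙 (isRLMax? σ q ×-dec (M ≟ toℕ (σ ⟨$⟩ʳ q)))
  split q rewrite 𝟙-×-dec (isRLMax? σ q) (M ≤? toℕ (σ ⟨$⟩ʳ q))
                | 𝟙-×-dec (isRLMax? σ q) (suc M ≤? toℕ (σ ⟨$⟩ʳ q))
                | 𝟙-×-dec (isRLMax? σ q) (M ≟ toℕ (σ ⟨$⟩ʳ q))
                | 𝟙-≤-split M (toℕ (σ ⟨$⟩ʳ q)) = *-distribˡ-+ (𝟙 (isRLMax? σ q)) _ _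

rlMaxesAt≤1 : ∀ (σ : Permutation′ n) M → rlMaxesAt σ M ≤ 1
rlMaxesAt≤1 {n} σ M = ∑-≤1 n _ (λ q → 𝟙≤1 (isRLMax? σ q ×-dec (M ≟ toℕ (σ ⟨$⟩ʳ q))))
  (λ i j p q → permutation-injective σ (toℕ-injective
     (trans (sym (proj₂ (𝟙-positive (isRLMax? σ i ×-dec _) p)))
            (proj₂ (𝟙-positive (isRLMax? σ j ×-dec _) q)))))

rlMaxesFrom-n : ∀ (σ : Permutation′ n) → rlMaxesFrom σ n ≡ 0
rlMaxesFrom-n {n} σ = ∑-zero n _ (λ q → 𝟙-no (isRLMax? σ q ×-dec (n ≤? toℕ (σ ⟨$⟩ʳ q)))
                                              (λ (_ , n≤σq) → <⇒≱ (toℕ<n (σ ⟨$⟩ʳ q)) n≤σq))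

-- Occurrences of 132 in an extended permutation

-- Appending the value W completes a pattern σᵢ σⱼ W of type 132.
Completes132 : Permutation′ n → ℕ → Set
Completes132 {n} σ W =
  Σ (Fin n) λ i → Σ (Fin n) λ j → i F.< j × toℕ (σ ⟨$⟩ʳ i) < W × W ≤ toℕ (σ ⟨$⟩ʳ j)

module _ (σ : Permutation′ n) (w : Fin (suc n)) where

  contains132-extend⁺ : Contains132 σ → Contains132 (extend σ w)
  contains132-extend⁺ (i , j , l , i<j , j<l , σi<σl , σl<σj) =
    inject₁ i , inject₁ j , inject₁ l , inject₁-mono-< i<j , inject₁-mono-< j<l ,
    extend-mono-< σ w i l σi<σl , extend-mono-< σ w l j σl<σj

  completes132⇒contains132-extend : Completes132 σ (toℕ w) → Contains132 (extend σ w)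
  completes132⇒contains132-extend (i , j , i<j , σi<w , w≤σj) =
    inject₁ i , inject₁ j , fromℕ n , inject₁-mono-< i<j , inject₁<fromℕ j ,
    extend-below-last σ w i σi<w , extend-above-last σ w j w≤σj

  contains132-extend⁻ : Contains132 (extend σ w) → Contains132 σ ⊎ Completes132 σ (toℕ w)
  contains132-extend⁻ (i , j , l , i<j , j<l , πi<πl , πl<πj) with view i | view j | view l
  ... | ‵fromℕ | _ | _ = ⊥-elim (fromℕ≮ _ i<j)
  ... | ‵inject₁ _ | ‵fromℕ | _ = ⊥-elim (fromℕ≮ _ j<l)
  ... | ‵inject₁ i′ | ‵inject₁ j′ | ‵fromℕ =
    inj₂ (i′ , j′ , inject₁-cancel-< i<j ,
          extend-below-last⁻ σ w i′ πi<πl , extend-above-last⁻ σ w j′ πl<πj)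
  ... | ‵inject₁ i′ | ‵inject₁ j′ | ‵inject₁ l′ =
    inj₁ (i′ , j′ , l′ , inject₁-cancel-< i<j , inject₁-cancel-< j<l ,
          extend-cancel-< σ w i′ l′ πi<πl , extend-cancel-< σ w l′ j′ πl<πj)

-- p = σ⁻¹(M) is a right-to-left maximum, since a later σⱼ > M would give Completes132 σ (M + 1) via (p, j).
¬completes132⇒afterDrop : ∀ (σ : Permutation′ n) W → W ≤ n → ¬ Completes132 σ W →
                          1 ≤ afterDrop (rlMaxesAt σ) W
¬completes132⇒afterDrop σ zero _ _ = ≤-refl
¬completes132⇒afterDrop {n} σ (suc M) M<n ¬completes =
  ∑-positive⁺ n _ p
    (≤-reflexive (sym (𝟙-yes (isRLMax? σ p ×-dec (M ≟ toℕ (σ ⟨$⟩ʳ p))) (p-max , sym σp≡M))))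
  where
  p = σ ⟨$⟩ˡ fromℕ< M<n
  σp≡M : toℕ (σ ⟨$⟩ʳ p) ≡ M
  σp≡M = trans (cong toℕ (inverseʳ σ)) (toℕ-fromℕ< M<n)
  p-max : IsRLMax σ p
  p-max j p<j with σ ⟨$⟩ʳ j F.<? σ ⟨$⟩ʳ p
  ... | yes σj<σp = σj<σp
  ... | no σj≮σp = ⊥-elim (¬completes (p , j , p<j , subst (_< suc M) (sym σp≡M) ≤-refl , M<σj))
    where
    M<σj : M < toℕ (σ ⟨$⟩ʳ j)
    M<σj = subst (_< toℕ (σ ⟨$⟩ʳ j)) σp≡M (≤∧≢⇒< (≮⇒≥ σj≮σp) σp≢σj)
      where
      σp≢σj : toℕ (σ ⟨$⟩ʳ p) ≢ toℕ (σ ⟨$⟩ʳ j)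
      σp≢σj σp≡σj = <-irrefl (cong toℕ (permutation-injective σ (toℕ-injective σp≡σj))) p<j

-- Let σₚ = M be a right-to-left maximum and σᵢ ≤ M < σⱼ with i < j: then p < j and p = j are
-- impossible, and j < p would make σᵢ σⱼ σₚ a 132.
afterDrop⇒¬completes132 : ∀ (σ : Permutation′ n) W → Avoids132 σ → 1 ≤ afterDrop (rlMaxesAt σ) W →
                          ¬ Completes132 σ W
afterDrop⇒¬completes132 σ zero _ _ (_ , _ , _ , () , _)
afterDrop⇒¬completes132 {n} σ (suc M) avoids drop (i , j , i<j , σi≤M , M<σj)
  with p , p∈ ← ∑-positive⁻ n _ drop
  with p-max , M≡σp ← 𝟙-positive (isRLMax? σ p ×-dec (M ≟ toℕ (σ ⟨$⟩ʳ p))) p∈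
  with <-cmp (toℕ p) (toℕ j)
... | tri< p<j _ _ = <-asym (p-max j p<j) (subst (_< toℕ (σ ⟨$⟩ʳ j)) M≡σp M<σj)
... | tri≈ _ p≡j _ = <-irrefl (trans M≡σp (cong (toℕ ∘ (σ ⟨$⟩ʳ_)) (toℕ-injective p≡j))) M<σj
... | tri> _ _ j<p = avoids (i , j , p , i<j , j<p , σi<σp , subst (_< toℕ (σ ⟨$⟩ʳ j)) M≡σp M<σj)
  where
  σi<σp : σ ⟨$⟩ʳ i F.< σ ⟨$⟩ʳ p
  σi<σp = subst (toℕ (σ ⟨$⟩ʳ i) <_) M≡σp (≤∧≢⇒< (≤-pred σi≤M) σi≢M)
    where
    σi≢M : toℕ (σ ⟨$⟩ʳ i) ≢ M
    σi≢M σi≡M = <-asym i<j (subst (λ x → toℕ j < toℕ x) (sym i≡p) j<p)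
      where
      i≡p : i ≡ p
      i≡p = permutation-injective σ (toℕ-injective (trans σi≡M M≡σp))

-- Counting the extensions that stay in A(n + 1, k)

contains132? : (π : Permutation′ n) → Dec (Contains132 π)
contains132? π = FP.any? λ i → FP.any? λ j → FP.any? λ l →
  (i F.<? j) ×-dec (j F.<? l) ×-dec (π ⟨$⟩ʳ i F.<? π ⟨$⟩ʳ l) ×-dec (π ⟨$⟩ʳ l F.<? π ⟨$⟩ʳ j)

avoids132? : (π : Permutation′ n) → Dec (Avoids132 π)
avoids132? π = ¬? (contains132? π)

InA : ℕ → Permutation′ n → Set
InA k π = Avoids132 π × shortValues π ≡ k

inA? : ∀ k (π : Permutation′ n) → Dec (InA k π)
inA? k π = avoids132? π ×-dec (shortValues π ≟ k)

module _ (k : ℕ) (σ : Permutation′ n) (w : Fin (suc n)) where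

  private
    drop = afterDrop (rlMaxesAt σ) (toℕ w)
    rest = rlMaxesFrom σ (toℕ w)

  inA-extend⁻ : InA k (extend σ w) → Avoids132 σ × 1 ≤ drop × rest + k ≡ n
  inA-extend⁻ (avoids , short≡k) =
      avoids ∘ contains132-extend⁺ σ w
    , ¬completes132⇒afterDrop σ (toℕ w) (≤-pred (toℕ<n w))
                              (avoids ∘ completes132⇒contains132-extend σ w)
    , trans (+-comm rest k) (subst (λ s → s + rest ≡ n) short≡k (shortValues-extend σ w))

  inA-extend⁺ : Avoids132 σ × 1 ≤ drop × rest + k ≡ n → InA k (extend σ w)
  inA-extend⁺ (avoids , dropped , rest+k≡n) =
      [ avoids , afterDrop⇒¬completes132 σ (toℕ w) avoids dropped ]′ ∘ contains132-extend⁻ σ w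
    , +-cancelʳ-≡ rest _ _ (trans (shortValues-extend σ w) (trans (sym rest+k≡n) (+-comm rest k)))

  𝟙-inA-extend : 𝟙 (inA? k (extend σ w)) ≡ 𝟙 (avoids132? σ) * (drop * 𝟙 (rest + k ≟ n))
  𝟙-inA-extend = begin
      𝟙 (inA? k (extend σ w))
        ≡⟨ 𝟙-cong (inA? k (extend σ w)) (avoids132? σ ×-dec (1 ≤? drop) ×-dec (rest + k ≟ n))
                  inA-extend⁻ inA-extend⁺ ⟩
      𝟙 (avoids132? σ ×-dec (1 ≤? drop) ×-dec (rest + k ≟ n))
        ≡⟨ 𝟙-×-dec (avoids132? σ) _ ⟩
      𝟙 (avoids132? σ) * 𝟙 ((1 ≤? drop) ×-dec (rest + k ≟ n))
        ≡⟨ cong (𝟙 (avoids132? σ) *_) (𝟙-×-dec (1 ≤? drop) (rest + k ≟ n)) ⟩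
      𝟙 (avoids132? σ) * (𝟙 (1 ≤? drop) * 𝟙 (rest + k ≟ n))
        ≡⟨ cong (λ d → 𝟙 (avoids132? σ) * (d * 𝟙 (rest + k ≟ n)))
                (sym (≤1⇒≡𝟙 drop drop≤1)) ⟩
      𝟙 (avoids132? σ) * (drop * 𝟙 (rest + k ≟ n)) ∎
    where
    open ≡-Reasoning
    drop≤1 : drop ≤ 1
    drop≤1 with toℕ w
    ... | zero = ≤-refl
    ... | suc M = rlMaxesAt≤1 σ M

count-extensions : ∀ k (σ : Permutation′ n) →
  ∑[ w < suc n ] 𝟙 (inA? k (extend σ w))
  ≡ 𝟙 (avoids132? σ) * (𝟙 (k ≤? n) * 𝟙 (shortValues σ ≤? k))
count-extensions {n} k σ = begin
    ∑[ w < suc n ] 𝟙 (inA? k (extend σ w))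
      ≡⟨ sum-cong-≗ {suc n} (𝟙-inA-extend k σ) ⟩
    ∑[ w < suc n ] (𝟙 (avoids132? σ) * hit (toℕ w))
      ≡⟨ sym (*-distribˡ-sum {suc n} (𝟙 (avoids132? σ)) (hit ∘ toℕ)) ⟩
    𝟙 (avoids132? σ) * ∑[ w < suc n ] hit (toℕ w)
      ≡⟨ cong (𝟙 (avoids132? σ) *_) (∑-afterDrop-level (rlMaxesFrom σ) (rlMaxesAt σ) (rlMaxesFrom-step σ)
                                       (rlMaxesAt≤1 σ) n k (rlMaxesFrom-n σ)) ⟩
    𝟙 (avoids132? σ) * (𝟙 (k ≤? n) * 𝟙 (n ≤? g₀ + k))
      ≡⟨ cong (λ z → 𝟙 (avoids132? σ) * (𝟙 (k ≤? n) * z))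
              (𝟙-cong (n ≤? g₀ + k) (s ≤? k) n≤g₀+k⇒s≤k s≤k⇒n≤g₀+k) ⟩
    𝟙 (avoids132? σ) * (𝟙 (k ≤? n) * 𝟙 (s ≤? k)) ∎
  where
  open ≡-Reasoning
  hit : ℕ → ℕ
  hit W = afterDrop (rlMaxesAt σ) W * 𝟙 (rlMaxesFrom σ W + k ≟ n)
  s = shortValues σ
  g₀ = rlMaxesFrom σ 0
  n≡s+g₀ : n ≡ s + g₀
  n≡s+g₀ = sym (shortValues+rlMaxesFrom0 σ)
  n≤g₀+k⇒s≤k : n ≤ g₀ + k → s ≤ k
  n≤g₀+k⇒s≤k n≤g₀+k = +-cancelʳ-≤ g₀ s k (subst₂ _≤_ n≡s+g₀ (+-comm g₀ k) n≤g₀+k)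
  s≤k⇒n≤g₀+k : s ≤ k → n ≤ g₀ + k
  s≤k⇒n≤g₀+k s≤k = subst₂ _≤_ (sym n≡s+g₀) (+-comm k g₀) (+-monoˡ-≤ g₀ s≤k)

extensions : List (Permutation′ n) → List (Permutation′ (suc n))
extensions [] = []
extensions (σ ∷ σs) = tabulate (extend σ) ++ extensions σs

permutations : ∀ n → List (Permutation′ n)
permutations zero = id ∷ []
permutations (suc n) = extensions (permutations n)

extensions-complete : ∀ {σs : List (Permutation′ n)} {π} w → Any (λ σ → π ≈ extend σ w) σs →
                      Any (π ≈_) (extensions σs)
extensions-complete {σs = σ ∷ σs} {π} w (here π≈) =
  AnyP.++⁺ˡ (AnyP.tabulate⁺ {P = π ≈_} {f = extend σ} w π≈)
extensions-complete {σs = σ ∷ σs} {π} w (there π∈) =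
  AnyP.++⁺ʳ {P = π ≈_} (tabulate (extend σ)) (extensions-complete {π = π} w π∈)

permutations-complete : ∀ n (π : Permutation′ n) → Any (π ≈_) (permutations n)
permutations-complete zero π = here (λ ())
permutations-complete (suc n) π = extensions-complete {π = π} (π ⟨$⟩ʳ fromℕ n)
  (Any.map (λ {σ} σ′≈σ i → trans (sym (insert-remove (fromℕ n) π i)) (extend-cong _ σ′≈σ i))
           (permutations-complete n (remove (fromℕ n) π)))

_≉_ : Permutation′ n → Permutation′ n → Set
σ ≉ τ = ¬ σ ≈ τ

extensions-disjoint : ∀ {σ : Permutation′ n} {τs} w →
                      All (σ ≉_) τs → All (extend σ w ≉_) (extensions τs)
extensions-disjoint w [] = []
extensions-disjoint {σ = σ} {τ ∷ τs} w (σ≉τ ∷ σ≉τs) =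
  AllP.++⁺ (AllP.tabulate⁺ {f = extend τ} (λ w′ e → σ≉τ (proj₁ (extend-injective {σ = σ} {τ} e))))
           (extensions-disjoint w σ≉τs)

extensions-unique : ∀ {σs : List (Permutation′ n)} → AllPairs _≉_ σs → AllPairs _≉_ (extensions σs)
extensions-unique [] = []
extensions-unique {σs = σ ∷ σs} (σ≉σs ∷ σs!) =
  AllPairsP.++⁺ (AllPairsP.tabulate⁺ {f = extend σ}
                   (λ w≢w′ e → w≢w′ (proj₂ (extend-injective {σ = σ} {σ} e))))
                (extensions-unique σs!) (AllP.tabulate⁺ {f = extend σ} λ w → extensions-disjoint w σ≉σs)

permutations-unique : ∀ n → AllPairs _≉_ (permutations n)
permutations-unique zero = [] ∷ []
permutations-unique (suc n) = extensions-unique (permutations-unique n)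

sum-map-extensions : ∀ (σs : List (Permutation′ n)) (f : Permutation′ (suc n) → ℕ) →
  sum (map f (extensions σs)) ≡ sum (map (λ σ → ∑[ w < suc n ] f (extend σ w)) σs)
sum-map-extensions [] f = refl
sum-map-extensions {n} (σ ∷ σs) f = trans (sum-map-++ f (tabulate (extend σ)) (extensions σs))
  (cong₂ _+_ (sum-map-tabulate (suc n) (extend σ) f) (sum-map-extensions σs f))

countA : ℕ → ℕ → ℕ
countA n k = sum (map (𝟙 ∘ inA? k) (permutations n))

sum-avoiders-≤ : ∀ k (σs : List (Permutation′ n)) →
  sum (map (λ σ → 𝟙 (avoids132? σ) * 𝟙 (shortValues σ ≤? k)) σs)
  ≡ ∑[ j < suc k ] sum (map (𝟙 ∘ inA? (toℕ j)) σs)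
sum-avoiders-≤ zero σs = trans (sum-map-cong σs λ σ → trans
    (cong (𝟙 (avoids132? σ) *_)
          (𝟙-cong (shortValues σ ≤? 0) (shortValues σ ≟ 0) n≤0⇒n≡0 ≤-reflexive))
    (sym (𝟙-×-dec (avoids132? σ) _)))
  (sym (+-identityʳ _))
sum-avoiders-≤ (suc k) σs = begin
    sum (map (λ σ → 𝟙 (avoids132? σ) * 𝟙 (shortValues σ ≤? suc k)) σs)
      ≡⟨ sum-map-cong σs split ⟩
    sum (map (λ σ → 𝟙 (avoids132? σ) * 𝟙 (shortValues σ ≤? k) + 𝟙 (inA? (suc k) σ)) σs)
      ≡⟨ sum-map-+ σs _ _ ⟩
    sum (map (λ σ → 𝟙 (avoids132? σ) * 𝟙 (shortValues σ ≤? k)) σs)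
    + sum (map (𝟙 ∘ inA? (suc k)) σs)
      ≡⟨ cong (_+ sum (map (𝟙 ∘ inA? (suc k)) σs)) (sum-avoiders-≤ k σs) ⟩
    ∑[ j < suc k ] sum (map (𝟙 ∘ inA? (toℕ j)) σs) + sum (map (𝟙 ∘ inA? (suc k)) σs)
      ≡⟨ sym (∑-toℕ-last (suc k) (λ j → sum (map (𝟙 ∘ inA? j) σs))) ⟩
    ∑[ j < suc (suc k) ] sum (map (𝟙 ∘ inA? (toℕ j)) σs) ∎
  where
  open ≡-Reasoning
  split : ∀ σ → 𝟙 (avoids132? σ) * 𝟙 (shortValues σ ≤? suc k)
              ≡ 𝟙 (avoids132? σ) * 𝟙 (shortValues σ ≤? k) + 𝟙 (inA? (suc k) σ)
  split σ = trans (cong (𝟙 (avoids132? σ) *_) (𝟙-≤-suc-split (shortValues σ) k))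
                  (trans (*-distribˡ-+ (𝟙 (avoids132? σ)) _ _)
                         (cong (𝟙 (avoids132? σ) * 𝟙 (shortValues σ ≤? k) +_)
                               (sym (𝟙-×-dec (avoids132? σ) _))))

countA-suc : ∀ n k → countA (suc n) k ≡ 𝟙 (k ≤? n) * ∑[ j < suc k ] countA n (toℕ j)
countA-suc n k = begin
    sum (map (𝟙 ∘ inA? k) (extensions (permutations n)))
      ≡⟨ sum-map-extensions (permutations n) _ ⟩
    sum (map (λ σ → ∑[ w < suc n ] 𝟙 (inA? k (extend σ w))) (permutations n))
      ≡⟨ sum-map-cong (permutations n) (λ σ → trans (count-extensions k σ)
                                                     (x*[y*z]≡y*[x*z] (𝟙 (avoids132? σ)) (𝟙 (k ≤? n)) _)) ⟩
    sum (map (λ σ → 𝟙 (k ≤? n) * (𝟙 (avoids132? σ) * 𝟙 (shortValues σ ≤? k))) (permutations n))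
      ≡⟨ sum-map-*ˡ (permutations n) (𝟙 (k ≤? n)) _ ⟩
    𝟙 (k ≤? n) * sum (map (λ σ → 𝟙 (avoids132? σ) * 𝟙 (shortValues σ ≤? k)) (permutations n))
      ≡⟨ cong (𝟙 (k ≤? n) *_) (sum-avoiders-≤ k (permutations n)) ⟩
    𝟙 (k ≤? n) * ∑[ j < suc k ] countA n (toℕ j) ∎
  where
  open ≡-Reasoning
  x*[y*z]≡y*[x*z] : ∀ x y z → x * (y * z) ≡ y * (x * z)
  x*[y*z]≡y*[x*z] = solve-∀

countA≡T : ∀ n k → countA (suc n) k ≡ T n k
countA≡T zero zero = trans (countA-suc zero zero) (sym (T[n,0]≡1 0))
countA≡T zero (suc k) = trans (countA-suc zero (suc k)) (sym (T[n,k]≡0 0 (suc k) (s≤s z≤n)))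
countA≡T (suc n) k with k ≤? suc n
... | yes k≤1+n = begin
    countA (suc (suc n)) k                           ≡⟨ countA-suc (suc n) k ⟩
    𝟙 (k ≤? suc n) * ∑[ j < suc k ] countA (suc n) (toℕ j)
      ≡⟨ cong₂ _*_ (𝟙-yes (k ≤? suc n) k≤1+n) (sum-cong-≗ {suc k} (countA≡T n ∘ toℕ)) ⟩
    1 * ∑[ j < suc k ] T n (toℕ j)                    ≡⟨ *-identityˡ _ ⟩
    ∑[ j < suc k ] T n (toℕ j)                        ≡⟨ ∑[j≤k]T[n,j]≡T[n+1,k] n k k≤1+n ⟩
    T (suc n) k                                      ∎
  where open ≡-Reasoning
... | no k≰1+n = trans (countA-suc (suc n) k)
  (trans (cong (_* ∑[ j < suc k ] countA (suc n) (toℕ j)) (𝟙-no (k ≤? suc n) k≰1+n))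
         (sym (T[n,k]≡0 (suc n) k (≰⇒> k≰1+n))))

isRLMax-cong : ∀ (σ τ : Permutation′ n) → σ ≈ τ → ∀ i → IsRLMax σ i → IsRLMax τ i
isRLMax-cong σ τ σ≈τ i max j i<j = subst₂ F._<_ (σ≈τ j) (σ≈τ i) (max j i<j)

contains132-cong : ∀ (σ τ : Permutation′ n) → σ ≈ τ → Contains132 σ → Contains132 τ
contains132-cong σ τ σ≈τ (i , j , l , i<j , j<l , σi<σl , σl<σj) =
  i , j , l , i<j , j<l ,
  subst₂ F._<_ (σ≈τ i) (σ≈τ l) σi<σl , subst₂ F._<_ (σ≈τ l) (σ≈τ j) σl<σj

shortValues-cong : ∀ (σ τ : Permutation′ n) → σ ≈ τ → shortValues σ ≡ shortValues τ
shortValues-cong {n} σ τ σ≈τ = begin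
    shortValues σ                     ≡⟨ shortValues≡∑ σ ⟩
    ∑[ i < n ] 𝟙 (¬? (isRLMax? σ i))
      ≡⟨ sum-cong-≗ {n} (λ i → 𝟙-cong (¬? (isRLMax? σ i)) (¬? (isRLMax? τ i))
                                 (λ ¬max → ¬max ∘ isRLMax-cong τ σ (sym ∘ σ≈τ) i)
                                 (λ ¬max → ¬max ∘ isRLMax-cong σ τ σ≈τ i)) ⟩
    ∑[ i < n ] 𝟙 (¬? (isRLMax? τ i))  ≡⟨ sym (shortValues≡∑ τ) ⟩
    shortValues τ                     ∎
  where open ≡-Reasoning

inA-cong : ∀ k (σ τ : Permutation′ n) → σ ≈ τ → InA k σ → InA k τ
inA-cong k σ τ σ≈τ (avoids , short≡k) =
  avoids ∘ contains132-cong τ σ (sym ∘ σ≈τ) , trans (sym (shortValues-cong σ τ σ≈τ)) short≡k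

enumA : ∀ n k → List (Setoid.Carrier (A n k))
enumA n k = filterΣ (inA? k) (permutations n)

module _ (n k : ℕ) where

  open import Data.List.Relation.Unary.Enumerates.Setoid (A n k) using (IsEnumeration)
  open import Data.List.Relation.Unary.Unique.Setoid (A n k) using (Unique)

  enumA-isEnumeration : IsEnumeration (enumA n k)
  enumA-isEnumeration π = filterΣ-complete (inA? k) _≈_ (λ {σ} {τ} → inA-cong k σ τ) π (permutations n)
                                           (permutations-complete n (proj₁ π))

  enumA-unique : Unique (enumA n k)
  enumA-unique = filterΣ-pairwise (inA? k) _≉_ (permutations n) (permutations-unique n)

length-enumA : ∀ n k → length (enumA (suc n) k) ≡ T n k
length-enumA n k = begin
  length (filterΣ (inA? k) πs)  ≡⟨ length-filterΣ (inA? k) πs ⟩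
  length (filter (inA? k) πs)   ≡⟨ length-filter≡sum-𝟙 (inA? k) πs ⟩
  countA (suc n) k              ≡⟨ countA≡T n k ⟩
  T n k                         ∎
  where
  open ≡-Reasoning
  πs = permutations (suc n)

mainTheorem2 : ∀ (n k : ℕ) → n ≥ 1 →
    Inverse (A n k) (setoid (Fin (T (n ∸ 1) k)))
mainTheorem2 (suc n) k _ = subst (λ m → Inverse (A (suc n) k) (setoid (Fin m))) (length-enumA n k)
  (enumeration⇒↔Fin (A (suc n) k) (enumA (suc n) k) (enumA-isEnumeration (suc n) k) (enumA-unique (suc n) k))
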